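{- Let $X$ be a nonempty set of regular choice functions for $L$, and let $K$ be a formal system with $\textsf{Ax}(K)\subseteq Taut(X)$ and whose inference rules are exactly Modus Ponens and $SV$. Then ${\rm PLS}(X,K)$ is sound: for all $\Sigma\cup\{\varphi\}\subseteq Sen(L_s)$, $\Sigma\vdash_K\varphi$ implies $\Sigma\models_X\varphi$.
   Context: $L$ is the propositional language with atoms $p_0,p_1,\ldots$ and connectives $\neg,\wedge$ (others defined); $L_s$ adds a primitive binary connective $|$; $\sim$ is classical equivalence on $Sen(L)$. A choice function for $L$ is a map $f$ with $f(\alpha,\beta)=f(\{\alpha,\beta\})\in\{\alpha,\beta\}$; it is regular if $\alpha\sim\alpha'$ implies $f(\alpha,\beta)\sim f(\alpha',\beta)$. $f$ induces $\overline f:Sen(L_s)\to Sen(L)$: identity on $Sen(L)$, commuting with $\neg,\wedge$, and $\overline f(\varphi|\psi)=f(\overline f(\varphi),\overline f(\psi))$. $\langle M,f\rangle\models_s\varphi$ iff $M\models\overline f(\varphi)$ ($M$ a classical truth assignment). $\Sigma\models_X\varphi$: every $\langle M,f\rangle$, $f\in X$, satisfying $\Sigma$ satisfies $\varphi$; $Taut(X)=\{\varphi:\emptyset\models_X\varphi\}$. $K_0$ is the system whose axioms are all $L_s$-instances of the schemes $\varphi\rightarrow(\psi\rightarrow\varphi)$, $(\varphi\rightarrow(\psi\rightarrow\sigma))\rightarrow((\varphi\rightarrow\psi)\rightarrow(\varphi\rightarrow\sigma))$, $(\neg\varphi\rightarrow\neg\psi)\rightarrow((\neg\varphi\rightarrow\psi)\rightarrow\varphi)$,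 $\varphi\wedge\psi\rightarrow\varphi|\psi$, $\varphi|\psi\rightarrow\varphi\vee\psi$, $\varphi|\psi\rightarrow\psi|\varphi$, with Modus Ponens as sole rule. The rule $SV$: from $\varphi\leftrightarrow\psi$ infer $\varphi|\sigma\leftrightarrow\psi|\sigma$ (any $\sigma$), provided $\varphi\leftrightarrow\psi$ is provable in $K_0$ (from no premises). $\Sigma\vdash_K\varphi$ means there is a finite sequence ending in $\varphi$ each member of which is in $\Sigma$, is an axiom of $K$, or follows from earlier members by a rule of $K$. -}

module Defs where

open import Data.Nat using (ℕ)
open import Data.Empty using (⊥)
open import Data.Bool using (Bool; true; false; not; _∧_)
open import Data.Product using (Σ; _×_; _,_; ∃)
open import Data.Sum using (_⊎_)
open import Relation.Binary.PropositionalEquality using (_≡_)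

data SenL : Set where
  atom : ℕ → SenL
  ¬L_  : SenL → SenL
  _∧L_ : SenL → SenL → SenL

data SenS : Set where
  atom : ℕ → SenS
  ¬S_  : SenS → SenS
  _∧S_ : SenS → SenS → SenS
  _∣S_ : SenS → SenS → SenS

_→S_ : SenS → SenS → SenS
φ →S ψ = ¬S (φ ∧S (¬S ψ))

_∨S_ : SenS → SenS → SenS
φ ∨S ψ = ¬S ((¬S φ) ∧S (¬S ψ))

_↔S_ : SenS → SenS → SenS
φ ↔S ψ = (φ →S ψ) ∧S (ψ →S φ)

embed : SenL → SenS
embed (atom n) = atom n
embed (¬L α) = ¬S (embed α)
embed (α ∧L β) = embed α ∧S embed β

Assignment : Set
Assignment = ℕ → Bool

eval : Assignment → SenL → Bool
eval M (atom n) = M n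
eval M (¬L α) = not (eval M α)
eval M (α ∧L β) = eval M α ∧ eval M β

_∼_ : SenL → SenL → Set
α ∼ β = ∀ (M : Assignment) → eval M α ≡ eval M β

-- Choice functions: f(α,β) = f({α,β}) ∈ {α,β}
record ChoiceFn : Set where
  field
    fn       : SenL → SenL → SenL
    sym-fn   : ∀ α β → fn α β ≡ fn β α
    chooses  : ∀ α β → (fn α β ≡ α) ⊎ (fn α β ≡ β)
open ChoiceFn public

Regular : ChoiceFn → Set
Regular f = ∀ α α' β → α ∼ α' → fn f α β ∼ fn f α' β

fbar : ChoiceFn → SenS → SenL
fbar f (atom n) = atom n
fbar f (¬S φ) = ¬L (fbar f φ)
fbar f (φ ∧S ψ) = fbar f φ ∧L fbar f ψ
fbar f (φ ∣S ψ) = fn f (fbar f φ) (fbar f ψ)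

_,_⊨s_ : Assignment → ChoiceFn → SenS → Set
M , f ⊨s φ = eval M (fbar f φ) ≡ true

ChoiceSet : Set₁
ChoiceSet = ChoiceFn → Set

SenSet : Set₁
SenSet = SenS → Set

_⊨[_]_ : SenSet → ChoiceSet → SenS → Set
Γ ⊨[ X ] φ = ∀ (f : ChoiceFn) → X f → ∀ (M : Assignment) →
             (∀ ψ → Γ ψ → M , f ⊨s ψ) → M , f ⊨s φ

Taut : ChoiceSet → SenSet
Taut X φ = (λ _ → ⊥) ⊨[ X ] φ

data K0Ax : SenS → Set where
  ax1 : ∀ φ ψ → K0Ax (φ →S (ψ →S φ))
  ax2 : ∀ φ ψ σ → K0Ax ((φ →S (ψ →S σ)) →S ((φ →S ψ) →S (φ →S σ)))
  ax3 : ∀ φ ψ → K0Ax (((¬S φ) →S (¬S ψ)) →S (((¬S φ) →S ψ) →S φ))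
  ax4 : ∀ φ ψ → K0Ax ((φ ∧S ψ) →S (φ ∣S ψ))
  ax5 : ∀ φ ψ → K0Ax ((φ ∣S ψ) →S (φ ∨S ψ))
  ax6 : ∀ φ ψ → K0Ax ((φ ∣S ψ) →S (ψ ∣S φ))

data ⊢K0 : SenS → Set where
  ax : ∀ {φ} → K0Ax φ → ⊢K0 φ
  mp : ∀ {φ ψ} → ⊢K0 φ → ⊢K0 (φ →S ψ) → ⊢K0 ψ

-- Σ ⊢_K φ for a system K with axiom set Ax and rules exactly MP and SV.
-- (Inductive rendering of "finite sequence ending in φ ...".)
data _⊢[_]_ (Γ : SenSet) (Ax : SenSet) : SenS → Set where
  hyp : ∀ {φ} → Γ φ → Γ ⊢[ Ax ] φ
  ax  : ∀ {φ} → Ax φ → Γ ⊢[ Ax ] φ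
  mp  : ∀ {φ ψ} → Γ ⊢[ Ax ] φ → Γ ⊢[ Ax ] (φ →S ψ) → Γ ⊢[ Ax ] ψ
  sv  : ∀ {φ ψ} (σ : SenS) → Γ ⊢[ Ax ] (φ ↔S ψ) → ⊢K0 (φ ↔S ψ) →
        Γ ⊢[ Ax ] ((φ ∣S σ) ↔S (ψ ∣S σ))

{-# OPTIONS --safe #-}
-- Every sentence of K₀ is translated by f̄ into a classical tautology, so ⊢K₀ φ ↔ ψ
-- makes f̄ φ and f̄ ψ classically equivalent; regularity of f then makes f̄ (φ | σ) and
-- f̄ (ψ | σ) equivalent too, which is the soundness of SV.  Modus Ponens preserves truth
-- in each fixed model ⟨M, f⟩, and hypotheses and axioms of K hold there by assumption.
module Submission where

open import Defs
open import Data.Product using (∃)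
open import Data.Bool using (Bool; true; false; not; _∧_)
open import Data.Sum using (_⊎_; inj₁; inj₂)
open import Relation.Binary.PropositionalEquality using (_≡_; refl; cong)

infixr 5 _⇒_ _∨′_
infix 5 _⇔_

-- The truth functions of the defined connectives →S, ∨S and ↔S, written the same way.
_⇒_ : Bool → Bool → Bool
a ⇒ b = not (a ∧ not b)

_∨′_ : Bool → Bool → Bool
a ∨′ b = not (not a ∧ not b)

_⇔_ : Bool → Bool → Bool
a ⇔ b = (a ⇒ b) ∧ (b ⇒ a)

⇒-mp : ∀ {a b} → a ≡ true → a ⇒ b ≡ true → b ≡ true
⇒-mp {b = true} _ _ = refl
⇒-mp {true} {false} refl ()

⇔-true⇒≡ : ∀ a b → a ⇔ b ≡ true → a ≡ b
⇔-true⇒≡ false false _ = refl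
⇔-true⇒≡ true true _ = refl
⇔-true⇒≡ false true ()
⇔-true⇒≡ true false ()

≡⇒⇔-true : ∀ {a b} → a ≡ b → a ⇔ b ≡ true
≡⇒⇔-true {false} refl = refl
≡⇒⇔-true {true} refl = refl

⇒-refl : ∀ a → a ⇒ a ≡ true
⇒-refl false = refl
⇒-refl true = refl

⇒-weaken : ∀ a b → a ⇒ (b ⇒ a) ≡ true
⇒-weaken false b = refl
⇒-weaken true false = refl
⇒-weaken true true = refl

⇒-distrib : ∀ a b c → (a ⇒ (b ⇒ c)) ⇒ ((a ⇒ b) ⇒ (a ⇒ c)) ≡ true
⇒-distrib false b c = refl
⇒-distrib true false c = refl
⇒-distrib true true false = refl
⇒-distrib true true true = refl

⇒-by-contradiction : ∀ a b → (not a ⇒ not b) ⇒ ((not a ⇒ b) ⇒ a) ≡ true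
⇒-by-contradiction false false = refl
⇒-by-contradiction false true = refl
⇒-by-contradiction true b = refl

∧⇒either : ∀ a b c → (c ≡ a) ⊎ (c ≡ b) → (a ∧ b) ⇒ c ≡ true
∧⇒either false b c _ = refl
∧⇒either true false c _ = refl
∧⇒either true true .true (inj₁ refl) = refl
∧⇒either true true .true (inj₂ refl) = refl

either⇒∨ : ∀ a b c → (c ≡ a) ⊎ (c ≡ b) → c ⇒ (a ∨′ b) ≡ true
either⇒∨ a b false _ = refl
either⇒∨ .true b true (inj₁ refl) = refl
either⇒∨ false .true true (inj₂ refl) = refl
either⇒∨ true .true true (inj₂ refl) = refl

eval-fn-chooses : ∀ f M α β →
  (eval M (fn f α β) ≡ eval M α) ⊎ (eval M (fn f α β) ≡ eval M β)
eval-fn-chooses f M α β with chooses f α β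
... | inj₁ e = inj₁ (cong (eval M) e)
... | inj₂ e = inj₂ (cong (eval M) e)

⊨s-mp : ∀ {M f} φ ψ → M , f ⊨s φ → M , f ⊨s (φ →S ψ) → M , f ⊨s ψ
⊨s-mp _ _ = ⇒-mp

K0Ax-valid : ∀ {θ} → K0Ax θ → ∀ f M → M , f ⊨s θ
K0Ax-valid (ax1 φ ψ) f M = ⇒-weaken (eval M (fbar f φ)) (eval M (fbar f ψ))
K0Ax-valid (ax2 φ ψ σ) f M =
  ⇒-distrib (eval M (fbar f φ)) (eval M (fbar f ψ)) (eval M (fbar f σ))
K0Ax-valid (ax3 φ ψ) f M = ⇒-by-contradiction (eval M (fbar f φ)) (eval M (fbar f ψ))
K0Ax-valid (ax4 φ ψ) f M =
  ∧⇒either _ _ _ (eval-fn-chooses f M (fbar f φ) (fbar f ψ))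
K0Ax-valid (ax5 φ ψ) f M =
  either⇒∨ _ _ _ (eval-fn-chooses f M (fbar f φ) (fbar f ψ))
K0Ax-valid (ax6 φ ψ) f M rewrite sym-fn f (fbar f φ) (fbar f ψ) =
  ⇒-refl (eval M (fn f (fbar f ψ) (fbar f φ)))

⊢K0-valid : ∀ {θ} → ⊢K0 θ → ∀ f M → M , f ⊨s θ
⊢K0-valid (ax a) f M = K0Ax-valid a f M
⊢K0-valid (mp {φ} {ψ} d e) f M = ⊨s-mp φ ψ (⊢K0-valid d f M) (⊢K0-valid e f M)

valid-↔⇒fbar-∼ : ∀ f φ ψ → (∀ M → M , f ⊨s (φ ↔S ψ)) → fbar f φ ∼ fbar f ψ
valid-↔⇒fbar-∼ f φ ψ valid M =
  ⇔-true⇒≡ (eval M (fbar f φ)) (eval M (fbar f ψ)) (valid M)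

SV-valid : ∀ f → Regular f → ∀ φ ψ σ → (∀ M → M , f ⊨s (φ ↔S ψ)) →
  ∀ M → M , f ⊨s ((φ ∣S σ) ↔S (ψ ∣S σ))
SV-valid f reg φ ψ σ valid M =
  ≡⇒⇔-true (reg (fbar f φ) (fbar f ψ) (fbar f σ) (valid-↔⇒fbar-∼ f φ ψ valid) M)

sound : ∀ {X Ax Γ φ} → (∀ f → X f → Regular f) → (∀ ψ → Ax ψ → Taut X ψ) →
  Γ ⊢[ Ax ] φ → Γ ⊨[ X ] φ
sound reg axT (hyp {φ} γ) f xf M M⊨Γ = M⊨Γ φ γ
sound reg axT (ax {φ} a) f xf M M⊨Γ = axT φ a f xf M (λ _ ())
sound reg axT (mp {φ} {ψ} d e) f xf M M⊨Γ =
  ⊨s-mp φ ψ (sound reg axT d f xf M M⊨Γ) (sound reg axT e f xf M M⊨Γ)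
sound reg axT (sv {φ} {ψ} σ _ k) f xf M M⊨Γ = SV-valid f (reg f xf) φ ψ σ (⊢K0-valid k f) M

theorem3p12 : (X : ChoiceSet) → (∀ f → X f → Regular f) → ∃ X →
    (Ax : SenSet) → (∀ φ → Ax φ → Taut X φ) →
    ∀ (Γ : SenSet) (φ : SenS) → Γ ⊢[ Ax ] φ → Γ ⊨[ X ] φ
theorem3p12 X reg _ Ax axT Γ φ = sound reg axT
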